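{- Let $m\geq 1$ and $n\geq 3$ be odd integers, and let $\Gamma=\mathbb Z_m\times\mathbb Z_{2n}$. Let $\Delta$ be the $2mn$-list consisting of $2mn-6$ copies of $(1,0)$, $3$ copies of $(2,0)$, and one copy each of $(0,2)$, $(0,n-2)$ and $(0,n)$. Then there exists a $\Delta$-permutation $\psi$ of $\Gamma$ such that $\psi(0,0)=(0,n)$ and $\psi(0,n)=(0,n+2)$.
   Context: Groups are written additively. A list is a multiset. For a group $\Gamma$ of order $v$ and a $v$-list $\Delta$ of elements of $\Gamma$, a $\Delta$-permutation of $\Gamma$ is a permutation $\varphi$ of $\Gamma$ such that the multiset $[\varphi(a)-a \mid a\in\Gamma]$ equals $\Delta$. -}

module Defs where

open import Data.Nat using (ℕ; zero; suc; _+_; _*_; _∸_; NonZero)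
open import Data.Nat.DivMod using (_mod_)
open import Data.Fin using (Fin; toℕ)
open import Data.Product using (_×_; _,_)
open import Data.List using (List; allFin; cartesianProduct; map; replicate; _++_; [_])
open import Data.List.Relation.Binary.Permutation.Propositional using (_↭_)
open import Function.Bundles using (_↔_; Inverse)
open import Data.Product using (Σ)
open import Relation.Binary.PropositionalEquality using (_≡_)

ι : (k : ℕ) .{{_ : NonZero k}} → ℕ → Fin k
ι k a = a mod k

addZ : (k : ℕ) .{{_ : NonZero k}} → Fin k → Fin k → Fin k
addZ k a b = ι k (toℕ a + toℕ b)

subZ : (k : ℕ) .{{_ : NonZero k}} → Fin k → Fin k → Fin k
subZ k a b = ι k (toℕ a + (k ∸ toℕ b))

Γ : ℕ → ℕ → Set
Γ m n = Fin m × Fin (2 * n)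

subΓ : (m n : ℕ) .{{_ : NonZero m}} .{{_ : NonZero (2 * n)}} → Γ m n → Γ m n → Γ m n
subΓ m n (a₁ , a₂) (b₁ , b₂) = subZ m a₁ b₁ , subZ (2 * n) a₂ b₂

el : (m n : ℕ) .{{_ : NonZero m}} .{{_ : NonZero (2 * n)}} → ℕ → ℕ → Γ m n
el m n a b = ι m a , ι (2 * n) b

allΓ : (m n : ℕ) → List (Γ m n)
allΓ m n = cartesianProduct (allFin m) (allFin (2 * n))

-- Δ-permutation: a permutation φ of Γ (a bijection Γ ↔ Γ) such that the
-- multiset [φ(a) - a | a ∈ Γ] equals Δ (lists equal up to reordering).
IsΔPermutation : (m n : ℕ) .{{_ : NonZero m}} .{{_ : NonZero (2 * n)}} →
                 List (Γ m n) → (Γ m n ↔ Γ m n) → Set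
IsΔPermutation m n Δ φ =
  map (λ a → subΓ m n (Inverse.to φ a) a) (allΓ m n) ↭ Δ

-- The list Δ of Theorem 2.4 (a 2mn-list when 2mn ≥ 6):
-- 2mn-6 copies of (1,0), 3 copies of (2,0), one each of (0,2), (0,n-2), (0,n).
Δ₂₄ : (m n : ℕ) .{{_ : NonZero m}} .{{_ : NonZero (2 * n)}} → List (Γ m n)
Δ₂₄ m n =
  replicate (2 * m * n ∸ 6) (el m n 1 0)
  ++ replicate 3 (el m n 2 0)
  ++ [ el m n 0 2 ] ++ [ el m n 0 (n ∸ 2) ] ++ [ el m n 0 n ]

IsOdd : ℕ → Set
IsOdd m = Σ ℕ λ k → m ≡ 2 * k + 1

-- ψ moves every point of Z_m × Z_{2n} one step in the first coordinate, except on the three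
-- rows y ∈ {0, n, n+2}: there (0, y) goes to (0, τ y), where τ is the cycle 0 ↦ n ↦ n+2 ↦ 0,
-- and (m-1, y) jumps over 0 to (1, y). So every difference is (1,0), except (2,0) on the three
-- jumps and (0,n), (0,2), (0,n-2) along the cycle. For m = 1 the jumps disappear, but then
-- (2,0) = (1,0) anyway. ψ is the composite of two fibrewise permutations of the product:
-- (x, y) ↦ (s_y x + 1, y), with s_y the transposition of 0 and m-1 on the three rows, followed by
-- (x, y) ↦ (x, τ y) on the column x = 0.

module Submission where

open import Defs
open import Data.Bool using (if_then_else_)
open import Data.Nat using (ℕ; zero; suc; _+_; _*_; _∸_; _≤_; _<_; NonZero; >-nonZero⁻¹; z<s)
open import Data.Nat.Properties
  using (+-assoc; +-comm; +-identityʳ; m+[n∸m]≡n; m∸n+n≡m; m+n∸m≡n; +-∸-assoc; [m+n]∸[m+o]≡n∸o;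
         *-assoc; *-comm; *-mono-≤; *-monoʳ-≤; <⇒≤; <⇒≱; <-trans; +-monoʳ-<; m<m+n; ∸-monoʳ-<;
         m+1+n≢0; m+1+n≢m; m∸n≡0⇒m≤n; n<1⇒n≡0; m≤n⇒m<n∨m≡n)
open import Data.Nat.DivMod using (_%_; m%n<n; %-distribˡ-+; m%n%n≡m%n; [m+n]%n≡m%n; m<n⇒m%n≡m)
open import Data.Fin using (Fin; toℕ; _≟_)
open import Data.Fin.Properties using (toℕ-injective; toℕ<n; toℕ-fromℕ<)
open import Data.Fin.Permutation using (transpose)
import Data.Fin.Permutation.Components as PC
open import Data.List using (List; []; _∷_; _++_; map; length; replicate; filter; cartesianProduct; allFin)
open import Data.List.Properties using (map-++; length-++; length-map; length-tabulate; ++-assoc; partition-defn)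
open import Data.List.Membership.Propositional using (_∈_; _∉_)
open import Data.List.Membership.Propositional.Properties using (∈-filter⁺; ∈-filter⁻; ∈-cartesianProduct⁺; ∈-allFin)
open import Data.List.Membership.Propositional.Properties.WithK using (unique∧set⇒bag)
import Data.List.Membership.DecPropositional as DecMembership
open import Data.List.Relation.Unary.Any using (here; there)
open import Data.List.Relation.Unary.All as All using (All; []; _∷_)
open import Data.List.Relation.Unary.All.Properties using (all-filter)
open import Data.List.Relation.Unary.AllPairs using ([]; _∷_)
open import Data.List.Relation.Unary.Unique.Propositional using (Unique)
open import Data.List.Relation.Unary.Unique.Propositional.Properties using (filter⁺; cartesianProduct⁺; allFin⁺)
open import Data.List.Relation.Binary.Pointwise using (Pointwise; Pointwise-≡⇒≡; []; _∷_)
open import Data.List.Relation.Binary.BagAndSetEquality using (∼bag⇒↭)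
open import Data.List.Relation.Binary.Permutation.Propositional
  using (_↭_; ↭-trans; ↭-reflexive; ↭ₛ⇒↭; module PermutationReasoning)
open import Data.List.Relation.Binary.Permutation.Propositional.Properties using (↭-length; ++⁺ʳ; map⁺; ++-comm)
import Data.List.Relation.Binary.Permutation.Setoid.Properties as ↭ₛ
open import Data.Product using (Σ; _×_; _,_; proj₁; proj₂)
open import Data.Product.Properties using (≡-dec)
open import Data.Sum using ([_,_]′)
open import Function.Base using (id; _∘_; case_of_)
open import Function.Bundles using (_↔_; Inverse; Injection; mk↔ₛ′; mk⇔)
open import Function.Construct.Composition using (_↔-∘_)
open import Function.Construct.Identity using (↔-id)
open import Function.Properties.Inverse using (↔⇒↣)
open import Relation.Binary.Definitions using (DecidableEquality)
open import Relation.Binary.PropositionalEquality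
open import Relation.Nullary using (yes; no; does)
open import Relation.Nullary.Decidable using (dec-true; dec-false)
open import Relation.Unary using (Decidable)
open import Relation.Unary.Properties using (∁?)

open Inverse using (to)

module _ (k : ℕ) .{{_ : NonZero k}} where

  toℕ-ι : ∀ a → toℕ (ι k a) ≡ a % k
  toℕ-ι a = toℕ-fromℕ< (m%n<n a k)

  ι-cong-% : ∀ {a b} → a % k ≡ b % k → ι k a ≡ ι k b
  ι-cong-% {a} {b} e = toℕ-injective (trans (toℕ-ι a) (trans e (sym (toℕ-ι b))))

  ι-toℕ : (u : Fin k) → ι k (toℕ u) ≡ u
  ι-toℕ u = toℕ-injective (trans (toℕ-ι (toℕ u)) (m<n⇒m%n≡m (toℕ<n u)))

  ι-toℕ-ι : ∀ a b → ι k (toℕ (ι k a) + b) ≡ ι k (a + b)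
  ι-toℕ-ι a b = ι-cong-% (begin
    (toℕ (ι k a) + b) % k   ≡⟨ cong (λ r → (r + b) % k) (toℕ-ι a) ⟩
    (a % k + b) % k         ≡⟨ %-distribˡ-+ (a % k) b k ⟩
    (a % k % k + b % k) % k ≡⟨ cong (λ r → (r + b % k) % k) (m%n%n≡m%n a k) ⟩
    (a % k + b % k) % k     ≡⟨ %-distribˡ-+ a b k ⟨
    (a + b) % k             ∎)
    where open ≡-Reasoning

  ι-+-modulus : ∀ a → ι k (a + k) ≡ ι k a
  ι-+-modulus a = ι-cong-% ([m+n]%n≡m%n a k)

  addZ-ι : ∀ a b → addZ k (ι k a) (ι k b) ≡ ι k (a + b)
  addZ-ι a b = begin
    ι k (toℕ (ι k a) + toℕ (ι k b)) ≡⟨ ι-toℕ-ι a _ ⟩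
    ι k (a + toℕ (ι k b))           ≡⟨ cong (ι k) (+-comm a _) ⟩
    ι k (toℕ (ι k b) + a)           ≡⟨ ι-toℕ-ι b a ⟩
    ι k (b + a)                     ≡⟨ cong (ι k) (+-comm b a) ⟩
    ι k (a + b)                     ∎
    where open ≡-Reasoning

  addZ-comm : ∀ u v → addZ k u v ≡ addZ k v u
  addZ-comm u v = cong (ι k) (+-comm (toℕ u) (toℕ v))

  subZ-addZ : ∀ u v → subZ k (addZ k u v) v ≡ u
  subZ-addZ u v = begin
    ι k (toℕ (ι k (toℕ u + toℕ v)) + (k ∸ toℕ v)) ≡⟨ ι-toℕ-ι _ _ ⟩
    ι k (toℕ u + toℕ v + (k ∸ toℕ v))            ≡⟨ cong (ι k) (+-assoc (toℕ u) _ _) ⟩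
    ι k (toℕ u + (toℕ v + (k ∸ toℕ v)))          ≡⟨ cong (λ r → ι k (toℕ u + r)) (m+[n∸m]≡n (<⇒≤ (toℕ<n v))) ⟩
    ι k (toℕ u + k)                              ≡⟨ ι-+-modulus (toℕ u) ⟩
    ι k (toℕ u)                                  ≡⟨ ι-toℕ u ⟩
    u                                            ∎
    where open ≡-Reasoning

  addZ-subZ : ∀ u v → addZ k u (subZ k v u) ≡ v
  addZ-subZ u v = begin
    addZ k u (subZ k v u)                         ≡⟨ addZ-comm u _ ⟩
    ι k (toℕ (ι k (toℕ v + (k ∸ toℕ u))) + toℕ u) ≡⟨ ι-toℕ-ι _ _ ⟩
    ι k (toℕ v + (k ∸ toℕ u) + toℕ u)             ≡⟨ cong (ι k) (+-assoc (toℕ v) _ _) ⟩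
    ι k (toℕ v + ((k ∸ toℕ u) + toℕ u))           ≡⟨ cong (λ r → ι k (toℕ v + r)) (m∸n+n≡m (<⇒≤ (toℕ<n u))) ⟩
    ι k (toℕ v + k)                               ≡⟨ ι-+-modulus (toℕ v) ⟩
    ι k (toℕ v)                                   ≡⟨ ι-toℕ v ⟩
    v                                             ∎
    where open ≡-Reasoning

  translation : Fin k → Fin k ↔ Fin k
  translation u = mk↔ₛ′ (addZ k u) (λ v → subZ k v u) (addZ-subZ u)
    (λ v → trans (cong (λ w → subZ k w u) (addZ-comm u v)) (subZ-addZ v u))

  subZ-≡ : ∀ {u v w} → u ≡ addZ k w v → subZ k u v ≡ w
  subZ-≡ {v = v} {w} refl = subZ-addZ w v

  ι-injective-< : ∀ {a b} → a < k → b < k → ι k a ≡ ι k b → a ≡ b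
  ι-injective-< {a} {b} a<k b<k e = begin
    a           ≡⟨ m<n⇒m%n≡m a<k ⟨
    a % k       ≡⟨ toℕ-ι a ⟨
    toℕ (ι k a) ≡⟨ cong toℕ e ⟩
    toℕ (ι k b) ≡⟨ toℕ-ι b ⟩
    b % k       ≡⟨ m<n⇒m%n≡m b<k ⟩
    b           ∎
    where open ≡-Reasoning

  addZ-identityˡ : ∀ u → addZ k (ι k 0) u ≡ u
  addZ-identityˡ u = trans (ι-toℕ-ι 0 (toℕ u)) (ι-toℕ u)

  subZ-self : ∀ u → subZ k u u ≡ ι k 0
  subZ-self u = subZ-≡ (sym (addZ-identityˡ u))

module _ {k : ℕ} where

  transpose-matchˡ : ∀ (i j : Fin k) → PC.transpose i j i ≡ j
  transpose-matchˡ i j rewrite dec-true (i ≟ i) refl = refl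

  transpose-matchʳ : ∀ (i j : Fin k) → PC.transpose i j j ≡ i
  transpose-matchʳ i j with j ≟ i
  ... | yes j≡i = j≡i
  ... | no _ rewrite dec-true (j ≟ j) refl = refl

  transpose-other : ∀ {i j l : Fin k} → l ≢ i → l ≢ j → PC.transpose i j l ≡ l
  transpose-other {i} {j} {l} l≢i l≢j rewrite dec-false (l ≟ i) l≢i | dec-false (l ≟ j) l≢j = refl

module _ {A B : Set} where

  fibrewise₁ : (B → A ↔ A) → (A × B) ↔ (A × B)
  fibrewise₁ π = mk↔ₛ′ (λ (x , y) → to (π y) x , y) (λ (x , y) → Inverse.from (π y) x , y)
    (λ (x , y) → cong (_, y) (Inverse.strictlyInverseˡ (π y) x))
    (λ (x , y) → cong (_, y) (Inverse.strictlyInverseʳ (π y) x))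

  fibrewise₂ : (A → B ↔ B) → (A × B) ↔ (A × B)
  fibrewise₂ π = mk↔ₛ′ (λ (x , y) → x , to (π x) y) (λ (x , y) → x , Inverse.from (π x) y)
    (λ (x , y) → cong (x ,_) (Inverse.strictlyInverseˡ (π x) y))
    (λ (x , y) → cong (x ,_) (Inverse.strictlyInverseʳ (π x) y))

module _ {A : Set} where

  ↭-filter-split : ∀ {P : A → Set} (P? : Decidable P) xs → xs ↭ filter P? xs ++ filter (∁? P?) xs
  ↭-filter-split P? xs = subst (λ p → xs ↭ proj₁ p ++ proj₂ p) (partition-defn P? xs)
    (↭ₛ⇒↭ (↭ₛ.partition-↭ (setoid A) P? xs))

  map-≡-replicate : ∀ {B : Set} {f : A → B} {c : B} {ys : List A} →
                    All (λ a → f a ≡ c) ys → map f ys ≡ replicate (length ys) c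
  map-≡-replicate []         = refl
  map-≡-replicate (fa≡c ∷ p) = cong₂ _∷_ fa≡c (map-≡-replicate p)

module _ {A : Set} (_≟_ : DecidableEquality A) where

  open DecMembership _≟_ using (_∈?_)

  filter-∈-↭ : ∀ {xs us : List A} → Unique xs → Unique us → All (_∈ xs) us →
               filter (_∈? us) xs ↭ us
  filter-∈-↭ {xs} {us} xs! us! us⊆xs = ∼bag⇒↭ (unique∧set⇒bag (filter⁺ (_∈? us) {xs} xs!) us!
    (mk⇔ (proj₂ ∘ ∈-filter⁻ (_∈? us) {xs = xs})
         (λ a∈us → ∈-filter⁺ (_∈? us) (All.lookup us⊆xs a∈us) a∈us)))

  map-↭-constant-outside : ∀ {B : Set} {xs us : List A} (f : A → B) (c : B) →
                           Unique xs → Unique us → All (_∈ xs) us → (∀ {a} → a ∉ us → f a ≡ c) →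
                           map f xs ↭ map f us ++ replicate (length xs ∸ length us) c
  map-↭-constant-outside {xs = xs} {us} f c xs! us! us⊆xs outside =
    ↭-trans (map⁺ f split) (↭-reflexive (begin
      map f (us ++ rest)                              ≡⟨ map-++ f us rest ⟩
      map f us ++ map f rest                          ≡⟨ cong (map f us ++_) (map-≡-replicate outside-rest) ⟩
      map f us ++ replicate (length rest) c           ≡⟨ cong (λ l → map f us ++ replicate l c) length-rest ⟨
      map f us ++ replicate (length xs ∸ length us) c ∎))
    where
    open ≡-Reasoning
    rest : List A
    rest = filter (∁? (_∈? us)) xs
    split : xs ↭ us ++ rest
    split = ↭-trans (↭-filter-split (_∈? us) xs) (++⁺ʳ rest (filter-∈-↭ xs! us! us⊆xs))
    outside-rest : All (λ a → f a ≡ c) rest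
    outside-rest = All.map outside (all-filter (∁? (_∈? us)) xs)
    length-rest : length xs ∸ length us ≡ length rest
    length-rest = trans (cong (_∸ length us) (trans (↭-length split) (length-++ us)))
                        (m+n∸m≡n (length us) (length rest))

length-cartesianProduct : ∀ {A B : Set} (xs : List A) (ys : List B) →
                          length (cartesianProduct xs ys) ≡ length xs * length ys
length-cartesianProduct []       ys = refl
length-cartesianProduct (x ∷ xs) ys = begin
  length (map (x ,_) ys ++ cartesianProduct xs ys)
    ≡⟨ length-++ (map (x ,_) ys) ⟩
  length (map (x ,_) ys) + length (cartesianProduct xs ys)
    ≡⟨ cong₂ _+_ (length-map (x ,_) ys) (length-cartesianProduct xs ys) ⟩
  length ys + length xs * length ys
    ∎
  where open ≡-Reasoning

replicate-+ : ∀ {A : Set} a b (x : A) → replicate (a + b) x ≡ replicate a x ++ replicate b x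
replicate-+ zero    b x = refl
replicate-+ (suc a) b x = cong (x ∷_) (replicate-+ a b x)

module _ (m n : ℕ) where

  allΓ-unique : Unique (allΓ m n)
  allΓ-unique = cartesianProduct⁺ (allFin⁺ m) (allFin⁺ (2 * n))

  ∈-allΓ : (a : Γ m n) → a ∈ allΓ m n
  ∈-allΓ (x , y) = ∈-cartesianProduct⁺ (∈-allFin x) (∈-allFin y)

  length-allΓ : length (allΓ m n) ≡ 2 * m * n
  length-allΓ = begin
    length (allΓ m n)                           ≡⟨ length-cartesianProduct (allFin m) (allFin (2 * n)) ⟩
    length (allFin m) * length (allFin (2 * n)) ≡⟨ cong₂ _*_ (length-tabulate {n = m} id) (length-tabulate id) ⟩
    m * (2 * n)                                 ≡⟨ *-assoc m 2 n ⟨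
    m * 2 * n                                   ≡⟨ cong (_* n) (*-comm m 2) ⟩
    2 * m * n                                   ∎
    where open ≡-Reasoning

module Construction (m n : ℕ) .{{_ : NonZero m}} .{{_ : NonZero (2 * n)}} (3≤n : 3 ≤ n) where

  open DecMembership (_≟_ {2 * n}) using (_∈?_)

  0ᵐ 1ᵐ -1ᵐ : Fin m
  0ᵐ  = ι m 0
  1ᵐ  = ι m 1
  -1ᵐ = ι m (m ∸ 1)

  c₀ c₁ c₂ : Fin (2 * n)
  c₀ = ι (2 * n) 0
  c₁ = ι (2 * n) n
  c₂ = ι (2 * n) (n + 2)

  -- Listed in the order in which the corresponding differences occur in Δ₂₄.
  C : List (Fin (2 * n))
  C = c₁ ∷ c₂ ∷ c₀ ∷ []

  τ : Fin (2 * n) ↔ Fin (2 * n)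
  τ = transpose c₀ c₂ ↔-∘ transpose c₀ c₁

  σ : Fin m ↔ Fin m
  σ = translation m 1ᵐ

  row : Fin (2 * n) → Fin m ↔ Fin m
  row y = σ ↔-∘ (if does (y ∈? C) then transpose 0ᵐ -1ᵐ else ↔-id (Fin m))

  column : Fin m → Fin (2 * n) ↔ Fin (2 * n)
  column x = if does (x ≟ 0ᵐ) then τ else ↔-id (Fin (2 * n))

  ψ : Γ m n ↔ Γ m n
  ψ = fibrewise₂ column ↔-∘ fibrewise₁ row

  n+2<2n : n + 2 < 2 * n
  n+2<2n = +-monoʳ-< n (subst (2 <_) (sym (+-identityʳ n)) 3≤n)

  n<2n : n < 2 * n
  n<2n = <-trans (m<m+n n z<s) n+2<2n

  c₀≢c₁ : c₀ ≢ c₁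
  c₀≢c₁ e with ι-injective-< (2 * n) (>-nonZero⁻¹ (2 * n)) n<2n e
  ... | 0≡n = case subst (3 ≤_) (sym 0≡n) 3≤n of λ ()

  c₀≢c₂ : c₀ ≢ c₂
  c₀≢c₂ = m+1+n≢0 n ∘ sym ∘ ι-injective-< (2 * n) (>-nonZero⁻¹ (2 * n)) n+2<2n

  c₁≢c₂ : c₁ ≢ c₂
  c₁≢c₂ = m+1+n≢m n ∘ sym ∘ ι-injective-< (2 * n) n<2n n+2<2n

  τ-c₀ : to τ c₀ ≡ c₁
  τ-c₀ = trans (cong (PC.transpose c₀ c₂) (transpose-matchˡ c₀ c₁))
               (transpose-other (≢-sym c₀≢c₁) c₁≢c₂)

  τ-c₁ : to τ c₁ ≡ c₂
  τ-c₁ = trans (cong (PC.transpose c₀ c₂) (transpose-matchʳ c₀ c₁)) (transpose-matchˡ c₀ c₂)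

  τ-c₂ : to τ c₂ ≡ c₀
  τ-c₂ = trans (cong (PC.transpose c₀ c₂) (transpose-other (≢-sym c₀≢c₂) (≢-sym c₁≢c₂)))
               (transpose-matchʳ c₀ c₂)

  τ-fixes : ∀ {y} → y ∉ C → to τ y ≡ y
  τ-fixes {y} y∉C = trans (cong (PC.transpose c₀ c₂) (transpose-other y≢c₀ y≢c₁))
                          (transpose-other y≢c₀ y≢c₂)
    where
    y≢c₀ : y ≢ c₀
    y≢c₀ = y∉C ∘ there ∘ there ∘ here
    y≢c₁ : y ≢ c₁
    y≢c₁ = y∉C ∘ here
    y≢c₂ : y ≢ c₂
    y≢c₂ = y∉C ∘ there ∘ here

  σ-last : to σ -1ᵐ ≡ 0ᵐ
  σ-last = begin
    addZ m (ι m 1) (ι m (m ∸ 1)) ≡⟨ addZ-ι m 1 (m ∸ 1) ⟩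
    ι m (1 + (m ∸ 1))            ≡⟨ cong (ι m) (m+[n∸m]≡n (>-nonZero⁻¹ m)) ⟩
    ι m m                        ≡⟨ ι-+-modulus m 0 ⟩
    0ᵐ                           ∎
    where open ≡-Reasoning

  σ-zero : to σ 0ᵐ ≡ 1ᵐ
  σ-zero = addZ-ι m 1 0

  row-∈ : ∀ {x y} → y ∈ C → to (row y) x ≡ to σ (PC.transpose 0ᵐ -1ᵐ x)
  row-∈ {y = y} y∈C rewrite dec-true (y ∈? C) y∈C = refl

  row-∉ : ∀ {x y} → y ∉ C → to (row y) x ≡ to σ x
  row-∉ {y = y} y∉C rewrite dec-false (y ∈? C) y∉C = refl

  column-0 : ∀ {y} → to (column 0ᵐ) y ≡ to τ y
  column-0 rewrite dec-true (0ᵐ ≟ 0ᵐ) refl = refl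

  column-≢ : ∀ {x y} → x ≢ 0ᵐ → to (column x) y ≡ y
  column-≢ {x} x≢0 rewrite dec-false (x ≟ 0ᵐ) x≢0 = refl

  column-∉ : ∀ {x y} → y ∉ C → to (column x) y ≡ y
  column-∉ {x} y∉C with x ≟ 0ᵐ
  ... | yes _ = τ-fixes y∉C
  ... | no _  = refl

  ψ-≡ : ∀ {x y x′ y′} → to (row y) x ≡ x′ → to (column x′) y ≡ y′ → to ψ (x , y) ≡ (x′ , y′)
  ψ-≡ refl refl = refl

  ψ-zero : ∀ {y} → y ∈ C → to ψ (0ᵐ , y) ≡ (0ᵐ , to τ y)
  ψ-zero y∈C = ψ-≡ (trans (row-∈ y∈C) (trans (cong (to σ) (transpose-matchˡ 0ᵐ -1ᵐ)) σ-last)) column-0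

  1ᵐ≢0ᵐ : 1 < m → 1ᵐ ≢ 0ᵐ
  1ᵐ≢0ᵐ 1<m e with ι-injective-< m 1<m (>-nonZero⁻¹ m) e
  ... | ()

  -1ᵐ≢0ᵐ : 1 < m → -1ᵐ ≢ 0ᵐ
  -1ᵐ≢0ᵐ 1<m = <⇒≱ 1<m ∘ m∸n≡0⇒m≤n ∘ ι-injective-< m (∸-monoʳ-< z<s (<⇒≤ 1<m)) (>-nonZero⁻¹ m)

  ψ-c₀ : to ψ (0ᵐ , c₀) ≡ (0ᵐ , c₁)
  ψ-c₀ = trans (ψ-zero (there (there (here refl)))) (cong (0ᵐ ,_) τ-c₀)

  ψ-c₁ : to ψ (0ᵐ , c₁) ≡ (0ᵐ , c₂)
  ψ-c₁ = trans (ψ-zero (here refl)) (cong (0ᵐ ,_) τ-c₁)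

  ψ-last : ∀ {y} → 1 < m → y ∈ C → to ψ (-1ᵐ , y) ≡ (1ᵐ , y)
  ψ-last 1<m y∈C = ψ-≡ (trans (row-∈ y∈C) (trans (cong (to σ) (transpose-matchʳ 0ᵐ -1ᵐ)) σ-zero))
    (column-≢ {1ᵐ} (1ᵐ≢0ᵐ 1<m))

  ψ-shift : ∀ {x y} → (y ∈ C → x ≢ 0ᵐ × x ≢ -1ᵐ) → to ψ (x , y) ≡ (to σ x , y)
  ψ-shift {x} {y} off with y ∈? C
  ... | no y∉C  = ψ-≡ (row-∉ y∉C) (column-∉ {to σ x} y∉C)
  ... | yes y∈C = ψ-≡ (trans (row-∈ y∈C) (cong (to σ) (transpose-other x≢0 x≢-1)))
                      (column-≢ {to σ x} (x≢-1 ∘ Injection.injective (↔⇒↣ σ) ∘ λ σx≡0 → trans σx≡0 (sym σ-last)))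
    where
    x≢0 : x ≢ 0ᵐ
    x≢0 = proj₁ (off y∈C)
    x≢-1 : x ≢ -1ᵐ
    x≢-1 = proj₂ (off y∈C)

  difference : Γ m n → Γ m n
  difference a = subΓ m n (to ψ a) a

  difference-≡ : ∀ {a b} → to ψ a ≡ b → difference a ≡ subΓ m n b a
  difference-≡ {a} = cong (λ b → subΓ m n b a)

  difference-shift : ∀ {x y} → (y ∈ C → x ≢ 0ᵐ × x ≢ -1ᵐ) → difference (x , y) ≡ el m n 1 0
  difference-shift {x} {y} off =
    trans (difference-≡ (ψ-shift off)) (cong₂ _,_ (subZ-addZ m 1ᵐ x) (subZ-self (2 * n) y))

  difference-zero : ∀ {y y′ b} → y ∈ C → to τ y ≡ y′ → y′ ≡ addZ (2 * n) (ι (2 * n) b) y →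
                    difference (0ᵐ , y) ≡ el m n 0 b
  difference-zero y∈C refl y′≡b+y =
    trans (difference-≡ (ψ-zero y∈C)) (cong₂ _,_ (subZ-self m 0ᵐ) (subZ-≡ (2 * n) y′≡b+y))

  difference-last : ∀ {y} → 1 < m → y ∈ C → difference (-1ᵐ , y) ≡ el m n 2 0
  difference-last {y} 1<m y∈C =
    trans (difference-≡ (ψ-last 1<m y∈C)) (cong₂ _,_ (subZ-≡ m (sym 2+-1≡1)) (subZ-self (2 * n) y))
    where
    2+-1≡1 : addZ m (ι m 2) -1ᵐ ≡ 1ᵐ
    2+-1≡1 = trans (addZ-ι m 2 (m ∸ 1))
                   (trans (cong (ι m ∘ suc) (m+[n∸m]≡n (>-nonZero⁻¹ m))) (ι-+-modulus m 1))

  difference-c₁ : difference (0ᵐ , c₁) ≡ el m n 0 2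
  difference-c₁ = difference-zero (here refl) τ-c₁
    (sym (trans (addZ-ι (2 * n) 2 n) (cong (ι (2 * n)) (+-comm 2 n))))

  difference-c₂ : difference (0ᵐ , c₂) ≡ el m n 0 (n ∸ 2)
  difference-c₂ = difference-zero (there (here refl)) τ-c₂
    (sym (trans (addZ-ι (2 * n) (n ∸ 2) (n + 2))
                (trans (cong (ι (2 * n)) n∸2+[n+2]≡2n) (ι-+-modulus (2 * n) 0))))
    where
    n∸2+[n+2]≡2n : n ∸ 2 + (n + 2) ≡ 2 * n
    n∸2+[n+2]≡2n = begin
      n ∸ 2 + (n + 2)  ≡⟨ cong (n ∸ 2 +_) (+-comm n 2) ⟩
      n ∸ 2 + (2 + n)  ≡⟨ +-assoc (n ∸ 2) 2 n ⟨
      n ∸ 2 + 2 + n    ≡⟨ cong (_+ n) (m∸n+n≡m (<⇒≤ 3≤n)) ⟩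
      n + n            ≡⟨ cong (n +_) (+-identityʳ n) ⟨
      2 * n            ∎
      where open ≡-Reasoning

  difference-c₀ : difference (0ᵐ , c₀) ≡ el m n 0 n
  difference-c₀ = difference-zero (there (there (here refl))) τ-c₀
    (sym (trans (addZ-ι (2 * n) n 0) (cong (ι (2 * n)) (+-identityʳ n))))

  Δ-cycle : List (Γ m n)
  Δ-cycle = el m n 0 2 ∷ el m n 0 (n ∸ 2) ∷ el m n 0 n ∷ []

  differences-cycle : Pointwise _≡_ (map difference (cartesianProduct (0ᵐ ∷ []) C)) Δ-cycle
  differences-cycle = difference-c₁ ∷ difference-c₂ ∷ difference-c₀ ∷ []

  C-unique : Unique C
  C-unique = (c₁≢c₂ ∷ ≢-sym c₀≢c₁ ∷ []) ∷ (≢-sym c₀≢c₂ ∷ []) ∷ [] ∷ []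

  differences-↭ : ∀ {X} → Unique X → 0ᵐ ∈ X → -1ᵐ ∈ X →
                  map difference (allΓ m n) ↭
                  map difference (cartesianProduct X C)
                    ++ replicate (2 * m * n ∸ length (cartesianProduct X C)) (el m n 1 0)
  differences-↭ {X} X! 0∈X -1∈X = ↭-trans
    (map-↭-constant-outside (≡-dec _≟_ _≟_) difference (el m n 1 0)
      (allΓ-unique m n) (cartesianProduct⁺ X! C-unique) (All.tabulate λ {a} _ → ∈-allΓ m n a) outside)
    (↭-reflexive (cong (λ l → map difference S ++ replicate (l ∸ length S) (el m n 1 0)) (length-allΓ m n)))
    where
    S : List (Γ m n)
    S = cartesianProduct X C
    outside : ∀ {a} → a ∉ S → difference a ≡ el m n 1 0
    outside {x , y} a∉S = difference-shift λ y∈C →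
      (λ x≡0 → a∉S (∈-cartesianProduct⁺ (subst (_∈ X) (sym x≡0) 0∈X) y∈C)) ,
      (λ x≡-1 → a∉S (∈-cartesianProduct⁺ (subst (_∈ X) (sym x≡-1) -1∈X) y∈C))

  isΔPermutation-1<m : 1 < m → IsΔPermutation m n (Δ₂₄ m n) ψ
  isΔPermutation-1<m 1<m = begin
    map difference (allΓ m n)                       ↭⟨ differences-↭ X-unique (there (here refl)) (here refl) ⟩
    map difference (cartesianProduct X C) ++ ones   ≡⟨ cong (_++ ones) (Pointwise-≡⇒≡ differences-X) ⟩
    (replicate 3 (el m n 2 0) ++ Δ-cycle) ++ ones   ↭⟨ ++-comm (replicate 3 (el m n 2 0) ++ Δ-cycle) ones ⟩
    Δ₂₄ m n                                         ∎
    where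
    open PermutationReasoning
    ones : List (Γ m n)
    ones = replicate (2 * m * n ∸ 6) (el m n 1 0)
    X : List (Fin m)
    X = -1ᵐ ∷ 0ᵐ ∷ []
    X-unique : Unique X
    X-unique = (-1ᵐ≢0ᵐ 1<m ∷ []) ∷ [] ∷ []
    differences-X : Pointwise _≡_ (map difference (cartesianProduct X C)) (replicate 3 (el m n 2 0) ++ Δ-cycle)
    differences-X = difference-last 1<m (here refl) ∷ difference-last 1<m (there (here refl))
      ∷ difference-last 1<m (there (there (here refl))) ∷ differences-cycle

  6≤2mn : 6 ≤ 2 * m * n
  6≤2mn = *-mono-≤ (*-monoʳ-≤ 2 (>-nonZero⁻¹ m)) 3≤n

  isΔPermutation-m≡1 : m ≡ 1 → IsΔPermutation m n (Δ₂₄ m n) ψ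
  isΔPermutation-m≡1 m≡1 = begin
    map difference (allΓ m n)
      ↭⟨ differences-↭ ([] ∷ []) (here refl) (here (Fin-m-trivial -1ᵐ 0ᵐ)) ⟩
    map difference (cartesianProduct (0ᵐ ∷ []) C) ++ replicate (2 * m * n ∸ 3) e₁
      ≡⟨ cong₂ _++_ (Pointwise-≡⇒≡ differences-cycle) padding ⟩
    Δ-cycle ++ (replicate (2 * m * n ∸ 6) e₁ ++ replicate 3 e₂)
      ↭⟨ ++-comm Δ-cycle _ ⟩
    (replicate (2 * m * n ∸ 6) e₁ ++ replicate 3 e₂) ++ Δ-cycle
      ≡⟨ ++-assoc (replicate (2 * m * n ∸ 6) e₁) _ Δ-cycle ⟩
    Δ₂₄ m n
      ∎
    where
    open PermutationReasoning
    e₁ e₂ : Γ m n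
    e₁ = el m n 1 0
    e₂ = el m n 2 0
    Fin-m-trivial : (u v : Fin m) → u ≡ v
    Fin-m-trivial u v = toℕ-injective (trans (toℕ≡0 u) (sym (toℕ≡0 v)))
      where
      toℕ≡0 : (w : Fin m) → toℕ w ≡ 0
      toℕ≡0 w = n<1⇒n≡0 (subst (toℕ w <_) m≡1 (toℕ<n w))
    ∸6+3≡∸3 : ∀ {t} → 6 ≤ t → t ∸ 6 + 3 ≡ t ∸ 3
    ∸6+3≡∸3 {t} 6≤t = trans (+-comm (t ∸ 6) 3) (trans (sym (+-∸-assoc 3 6≤t)) ([m+n]∸[m+o]≡n∸o 3 t 3))
    padding : replicate (2 * m * n ∸ 3) e₁ ≡ replicate (2 * m * n ∸ 6) e₁ ++ replicate 3 e₂
    padding = trans (cong (λ l → replicate l e₁) (sym (∸6+3≡∸3 6≤2mn)))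
      (trans (replicate-+ (2 * m * n ∸ 6) 3 e₁)
             (cong (λ e → replicate (2 * m * n ∸ 6) e₁ ++ replicate 3 e) (cong (_, c₀) (Fin-m-trivial 1ᵐ (ι m 2)))))

theorem2p4 : (m n : ℕ) → 1 ≤ m → 3 ≤ n → IsOdd m → IsOdd n →
    .{{_ : NonZero m}} .{{_ : NonZero (2 Data.Nat.* n)}} →
    Σ (Γ m n ↔ Γ m n) λ ψ →
      IsΔPermutation m n (Δ₂₄ m n) ψ
      × (Inverse.to ψ (el m n 0 0) ≡ el m n 0 n)
      × (Inverse.to ψ (el m n 0 n) ≡ el m n 0 (n Data.Nat.+ 2))
theorem2p4 m n 1≤m 3≤n _ _ =
  ψ , [ isΔPermutation-1<m , isΔPermutation-m≡1 ∘ sym ]′ (m≤n⇒m<n∨m≡n 1≤m) , ψ-c₀ , ψ-c₁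
  where open Construction m n 3≤n
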